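{- Let $\ell\ge 1$ and $n\ge 0$ be integers. If $\binom{\ell}{4}+3<2^n$, then there exists a no-quads set of $\ell$ cards in the EvenQuads-$2^n$ deck.
   Context: The EvenQuads-$2^n$ deck is the set $\mathbb{Z}_2^n$, whose elements are called cards. A quad is a set of four distinct cards $\vec a,\vec b,\vec c,\vec d$ with $\vec a+\vec b+\vec c+\vec d=\vec 0$. A no-quads set is a set of distinct cards containing no quad. -}

module Defs where

open import Data.Bool using (Bool; false; _xor_)
open import Data.Nat using (ℕ)
open import Data.Fin using (Fin)
open import Data.Vec using (Vec; zipWith; replicate)
open import Data.Product using (_×_)
open import Relation.Binary.PropositionalEquality using (_≡_; _≢_)
open import Function.Definitions using (Injective)
open import Relation.Nullary using (¬_)

-- A card of the EvenQuads-2^n deck: an element of (ℤ₂)^n, as a bit vector.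
Card : ℕ → Set
Card n = Vec Bool n

_⊕_ : ∀ {n} → Card n → Card n → Card n
_⊕_ = zipWith _xor_

infixl 6 _⊕_

𝟎 : ∀ {n} → Card n
𝟎 {n} = replicate n false

IsQuad : ∀ {n} → Card n → Card n → Card n → Card n → Set
IsQuad a b c d =
  (a ≢ b) × (a ≢ c) × (a ≢ d) × (b ≢ c) × (b ≢ d) × (c ≢ d) ×
  (a ⊕ b ⊕ c ⊕ d ≡ 𝟎)

-- A set of ℓ distinct cards is an injective family Fin ℓ → Card n.
-- It is a no-quads set if no four of its cards form a quad.
NoQuads : ∀ {ℓ n} → (Fin ℓ → Card n) → Set
NoQuads {ℓ} S =
  (i j k m : Fin ℓ) → ¬ IsQuad (S i) (S j) (S k) (S m)

NoQuadsSet : ∀ {n} (ℓ : ℕ) → (Fin ℓ → Card n) → Set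
NoQuadsSet {n} ℓ S = Injective _≡_ _≡_ S × NoQuads S

module Submission where

-- A no-quads set S of k cards stays one after adding any card c
-- that is neither in S nor the sum of three distinct cards of S, because in Z₂ⁿ a
-- member of a quad is the sum of the other three.  At most k + C(k,3) cards are thus
-- excluded, and k + C(k,3) ≤ C(k+1,4) + 3 ≤ C(ℓ,4) + 3 < 2ⁿ for every k < ℓ, so the
-- greedy process never gets stuck before reaching ℓ cards.

open import Defs
open import Data.Nat using (ℕ; _≥_; _+_; _<_; _^_)
open import Data.Nat.Combinatorics using (_C_)
open import Data.Fin using (Fin)
open import Data.Product using (Σ)

open import Data.Bool using (Bool; true; false)
open import Data.Bool.Properties using (xor-assoc; xor-comm; xor-identityˡ; xor-identityʳ; xor-same)
open import Data.Empty using (⊥-elim)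
open import Data.Fin using (zero; suc)
open import Data.List using (List; []; _∷_; [_]; _++_; map; length)
open import Data.List.Membership.Propositional using (_∈_; _∉_)
open import Data.List.Membership.Propositional.Properties using (∈-++⁺ˡ; ∈-++⁺ʳ; ∈-map⁺)
open import Data.List.Properties using (length-++; length-map)
open import Data.List.Relation.Unary.Any using (here; there)
open import Data.Nat using (zero; suc; _≤_; _≤′_; ≤′-refl; ≤′-step; z≤n; s≤s; _<?_)
open import Data.Nat.Combinatorics using (nC1≡n; nCk+nC[k+1]≡[n+1]C[k+1])
open import Data.Nat.Properties
open import Data.Product using (∃; _,_)
open import Data.Vec using ([]; _∷_)
open import Data.Vec.Functional using (head; tail) renaming (_∷_ to _◂_)
open import Data.Vec.Properties using (zipWith-assoc; zipWith-comm; zipWith-identityˡ; zipWith-identityʳ)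
open import Function using (_∘_)
open import Function.Definitions using (Injective)
open import Relation.Binary.PropositionalEquality
  using (_≡_; _≢_; refl; sym; trans; cong; cong₂; subst; ≢-sym; module ≡-Reasoning)
open import Relation.Nullary using (¬_; yes; no)

module _ {n : ℕ} where

  ⊕-assoc : (a b c : Card n) → a ⊕ b ⊕ c ≡ a ⊕ (b ⊕ c)
  ⊕-assoc = zipWith-assoc xor-assoc

  ⊕-comm : (a b : Card n) → a ⊕ b ≡ b ⊕ a
  ⊕-comm = zipWith-comm xor-comm

  ⊕-identityˡ : (a : Card n) → 𝟎 ⊕ a ≡ a
  ⊕-identityˡ = zipWith-identityˡ xor-identityˡ

  ⊕-identityʳ : (a : Card n) → a ⊕ 𝟎 ≡ a
  ⊕-identityʳ = zipWith-identityʳ xor-identityʳ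

⊕-same : ∀ {n} (a : Card n) → a ⊕ a ≡ 𝟎
⊕-same []      = refl
⊕-same (x ∷ a) = cong₂ _∷_ (xor-same x) (⊕-same a)

⊕≡𝟎⇒≡ : ∀ {n} {a b : Card n} → a ⊕ b ≡ 𝟎 → a ≡ b
⊕≡𝟎⇒≡ {a = a} {b} a⊕b≡𝟎 = begin
  a            ≡⟨ sym (⊕-identityʳ a) ⟩
  a ⊕ 𝟎        ≡⟨ cong (a ⊕_) (sym (⊕-same b)) ⟩
  a ⊕ (b ⊕ b)  ≡⟨ sym (⊕-assoc a b b) ⟩
  a ⊕ b ⊕ b    ≡⟨ cong (_⊕ b) a⊕b≡𝟎 ⟩
  𝟎 ⊕ b        ≡⟨ ⊕-identityˡ b ⟩
  b            ∎
  where open ≡-Reasoning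

⊕-rotate : ∀ {n} (a b c d : Card n) → a ⊕ b ⊕ c ⊕ d ≡ b ⊕ c ⊕ d ⊕ a
⊕-rotate a b c d = begin
  a ⊕ b ⊕ c ⊕ d      ≡⟨ cong (_⊕ d) (⊕-assoc a b c) ⟩
  a ⊕ (b ⊕ c) ⊕ d    ≡⟨ ⊕-assoc a (b ⊕ c) d ⟩
  a ⊕ (b ⊕ c ⊕ d)    ≡⟨ ⊕-comm a (b ⊕ c ⊕ d) ⟩
  b ⊕ c ⊕ d ⊕ a      ∎
  where open ≡-Reasoning

module _ {n : ℕ} {a b c d : Card n} where

  isQuad-rotate : IsQuad a b c d → IsQuad b c d a
  isQuad-rotate (a≢b , a≢c , a≢d , b≢c , b≢d , c≢d , sum≡𝟎) =
    b≢c , b≢d , ≢-sym a≢b , c≢d , ≢-sym a≢c , ≢-sym a≢d ,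
    trans (sym (⊕-rotate a b c d)) sum≡𝟎

  isQuad⇒≡⊕ : IsQuad a b c d → d ≡ a ⊕ b ⊕ c
  isQuad⇒≡⊕ (_ , _ , _ , _ , _ , _ , sum≡𝟎) = sym (⊕≡𝟎⇒≡ sum≡𝟎)

module _ {n k : ℕ} {S : Fin k → Card n} {c : Card n}
         (c∉S : ∀ i → c ≢ S i)
         (c∉S⊕S⊕S : ∀ i j m → i ≢ j → i ≢ m → j ≢ m → c ≢ S i ⊕ S j ⊕ S m)
         where

  ◂-injective : Injective _≡_ _≡_ S → Injective _≡_ _≡_ (c ◂ S)
  ◂-injective inj {zero}  {zero}  _  = refl
  ◂-injective inj {zero}  {suc j} eq = ⊥-elim (c∉S j eq)
  ◂-injective inj {suc i} {zero}  eq = ⊥-elim (c∉S i (sym eq))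
  ◂-injective inj {suc i} {suc j} eq = cong suc (inj eq)

  ◂-noQuads : NoQuads S → NoQuads (c ◂ S)
  ◂-noQuads noQuads = go
    where
    no-quad-ending-in-c : ∀ i j m → ¬ IsQuad (S i) (S j) (S m) c
    no-quad-ending-in-c i j m q@(Si≢Sj , Si≢Sm , _ , Sj≢Sm , _) =
      c∉S⊕S⊕S i j m (Si≢Sj ∘ cong S) (Si≢Sm ∘ cong S) (Sj≢Sm ∘ cong S) (isQuad⇒≡⊕ q)

    -- A quad through c is rotated until c is its last card.
    go : NoQuads (c ◂ S)
    go (suc i) (suc j) (suc m) (suc o) q = noQuads i j m o q
    go (suc i) (suc j) (suc m) zero    q = no-quad-ending-in-c i j m q
    go (suc i) (suc j) zero    (suc o) q =
      no-quad-ending-in-c o i j (isQuad-rotate (isQuad-rotate (isQuad-rotate q)))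
    go (suc i) zero    (suc m) (suc o) q =
      no-quad-ending-in-c m o i (isQuad-rotate (isQuad-rotate q))
    go zero    (suc j) (suc m) (suc o) q = no-quad-ending-in-c j m o (isQuad-rotate q)
    go zero    zero    _       _       (a≢b , _)                     = a≢b refl
    go zero    (suc _) zero    _       (_ , a≢c , _)                 = a≢c refl
    go zero    (suc _) (suc _) zero    (_ , _ , a≢d , _)             = a≢d refl
    go (suc _) zero    zero    _       (_ , _ , _ , b≢c , _)         = b≢c refl
    go (suc _) zero    (suc _) zero    (_ , _ , _ , _ , b≢d , _)     = b≢d refl
    go (suc _) (suc _) zero    zero    (_ , _ , _ , _ , _ , c≢d , _) = c≢d refl

  ◂-noQuadsSet : NoQuadsSet k S → NoQuadsSet (suc k) (c ◂ S)
  ◂-noQuadsSet (inj , noQuads) = ◂-injective inj , ◂-noQuads noQuads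

subsetSums : ∀ {n k} → ℕ → (Fin k → Card n) → List (Card n)
subsetSums             zero    S = [ 𝟎 ]
subsetSums {k = zero}  (suc r) S = []
subsetSums {k = suc k} (suc r) S =
  subsetSums (suc r) (tail S) ++ map (head S ⊕_) (subsetSums r (tail S))

length-subsetSums : ∀ {n} k r (S : Fin k → Card n) → length (subsetSums r S) ≡ k C r
length-subsetSums k       zero    S = refl
length-subsetSums zero    (suc r) S = refl
length-subsetSums (suc k) (suc r) S = begin
  length (subsetSums (suc r) (tail S) ++ map (head S ⊕_) (subsetSums r (tail S)))
    ≡⟨ length-++ (subsetSums (suc r) (tail S)) ⟩
  length (subsetSums (suc r) (tail S)) + length (map (head S ⊕_) (subsetSums r (tail S)))
    ≡⟨ cong₂ _+_ (length-subsetSums k (suc r) (tail S))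
                 (trans (length-map _ (subsetSums r (tail S))) (length-subsetSums k r (tail S))) ⟩
  k C suc r + k C r
    ≡⟨ +-comm (k C suc r) (k C r) ⟩
  k C r + k C suc r
    ≡⟨ nCk+nC[k+1]≡[n+1]C[k+1] k r ⟩
  suc k C suc r
    ∎
  where open ≡-Reasoning

module _ {n k : ℕ} (S : Fin (suc k) → Card n) {r : ℕ} {x : Card n} where

  ∈-subsetSums-tail : x ∈ subsetSums (suc r) (tail S) → x ∈ subsetSums (suc r) S
  ∈-subsetSums-tail = ∈-++⁺ˡ

  ∈-subsetSums-head : x ∈ subsetSums r (tail S) → head S ⊕ x ∈ subsetSums (suc r) S
  ∈-subsetSums-head = ∈-++⁺ʳ _ ∘ ∈-map⁺ (head S ⊕_)

∈-subsetSums₁ : ∀ {n k} (S : Fin k → Card n) i → S i ∈ subsetSums 1 S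
∈-subsetSums₁ S zero    =
  subst (_∈ subsetSums 1 S) (⊕-identityʳ (S zero)) (∈-subsetSums-head S {r = 0} (here refl))
∈-subsetSums₁ S (suc i) = ∈-subsetSums-tail S (∈-subsetSums₁ (tail S) i)

∈-subsetSums₂ : ∀ {n k} (S : Fin k → Card n) i j → i ≢ j → S i ⊕ S j ∈ subsetSums 2 S
∈-subsetSums₂ S zero    zero    i≢j = ⊥-elim (i≢j refl)
∈-subsetSums₂ S zero    (suc j) _   = ∈-subsetSums-head S (∈-subsetSums₁ (tail S) j)
∈-subsetSums₂ S (suc i) zero    _   =
  subst (_∈ _) (⊕-comm (S zero) (S (suc i))) (∈-subsetSums-head S (∈-subsetSums₁ (tail S) i))
∈-subsetSums₂ S (suc i) (suc j) i≢j =
  ∈-subsetSums-tail S (∈-subsetSums₂ (tail S) i j (i≢j ∘ cong suc))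

∈-subsetSums₃ : ∀ {n k} (S : Fin k → Card n) i j m → i ≢ j → i ≢ m → j ≢ m →
                S i ⊕ S j ⊕ S m ∈ subsetSums 3 S
∈-subsetSums₃ S zero    zero    _       i≢j _   _   = ⊥-elim (i≢j refl)
∈-subsetSums₃ S zero    (suc _) zero    _   i≢m _   = ⊥-elim (i≢m refl)
∈-subsetSums₃ S (suc _) zero    zero    _   _   j≢m = ⊥-elim (j≢m refl)
∈-subsetSums₃ S zero    (suc j) (suc m) _   _   j≢m =
  subst (_∈ subsetSums 3 S) (sym (⊕-assoc (S zero) (S (suc j)) (S (suc m))))
    (∈-subsetSums-head S (∈-subsetSums₂ (tail S) j m (j≢m ∘ cong suc)))
∈-subsetSums₃ S (suc i) zero    (suc m) _   i≢m _   =
  subst (_∈ subsetSums 3 S)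
    (trans (sym (⊕-assoc (S zero) (S (suc i)) (S (suc m))))
           (cong (_⊕ S (suc m)) (⊕-comm (S zero) (S (suc i)))))
    (∈-subsetSums-head S (∈-subsetSums₂ (tail S) i m (i≢m ∘ cong suc)))
∈-subsetSums₃ S (suc i) (suc j) zero    i≢j _   _   =
  subst (_∈ subsetSums 3 S) (⊕-comm (S zero) (S (suc i) ⊕ S (suc j)))
    (∈-subsetSums-head S (∈-subsetSums₂ (tail S) i j (i≢j ∘ cong suc)))
∈-subsetSums₃ S (suc i) (suc j) (suc m) i≢j i≢m j≢m =
  ∈-subsetSums-tail S
    (∈-subsetSums₃ (tail S) i j m (i≢j ∘ cong suc) (i≢m ∘ cong suc) (j≢m ∘ cong suc))

tailsWith : ∀ {n} → Bool → List (Card (suc n)) → List (Card n)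
tailsWith _     []                 = []
tailsWith true  ((true  ∷ v) ∷ vs) = v ∷ tailsWith true vs
tailsWith true  ((false ∷ _) ∷ vs) = tailsWith true vs
tailsWith false ((true  ∷ _) ∷ vs) = tailsWith false vs
tailsWith false ((false ∷ v) ∷ vs) = v ∷ tailsWith false vs

∈-tailsWith : ∀ {n} {b} {v : Card n} {vs} → b ∷ v ∈ vs → v ∈ tailsWith b vs
∈-tailsWith {b = true}  (here refl) = here refl
∈-tailsWith {b = false} (here refl) = here refl
∈-tailsWith {b = true}  {vs = (true  ∷ _) ∷ _} (there p) = there (∈-tailsWith p)
∈-tailsWith {b = true}  {vs = (false ∷ _) ∷ _} (there p) = ∈-tailsWith p
∈-tailsWith {b = false} {vs = (true  ∷ _) ∷ _} (there p) = ∈-tailsWith p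
∈-tailsWith {b = false} {vs = (false ∷ _) ∷ _} (there p) = there (∈-tailsWith p)

length-tailsWith : ∀ {n} (vs : List (Card (suc n))) →
                   length (tailsWith true vs) + length (tailsWith false vs) ≡ length vs
length-tailsWith []                 = refl
length-tailsWith ((true  ∷ _) ∷ vs) = cong suc (length-tailsWith vs)
length-tailsWith ((false ∷ _) ∷ vs) =
  trans (+-suc (length (tailsWith true vs)) _) (cong suc (length-tailsWith vs))

-- One half of the deck, split by the first bit, contains fewer than 2ⁿ⁻¹ cards of vs.
∃-∉ : ∀ n (vs : List (Card n)) → length vs < 2 ^ n → ∃ λ c → c ∉ vs
∃-∉ zero    []      _ = [] , λ ()
∃-∉ zero    (_ ∷ _) (s≤s ())
∃-∉ (suc n) vs |vs|<2^[1+n] with length (tailsWith true vs) <? 2 ^ n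
... | yes |T|<2^n = let c , c∉T = ∃-∉ n _ |T|<2^n in true ∷ c , c∉T ∘ ∈-tailsWith
... | no  |T|≮2^n = let c , c∉F = ∃-∉ n _ |F|<2^n in false ∷ c , c∉F ∘ ∈-tailsWith
  where
  open ≤-Reasoning
  |F|<2^n : length (tailsWith false vs) < 2 ^ n
  |F|<2^n = +-cancelˡ-< (2 ^ n) _ _ (begin-strict
    2 ^ n + length (tailsWith false vs)
      ≤⟨ +-monoˡ-≤ _ (≮⇒≥ |T|≮2^n) ⟩
    length (tailsWith true vs) + length (tailsWith false vs)
      ≡⟨ length-tailsWith vs ⟩
    length vs
      <⟨ |vs|<2^[1+n] ⟩
    2 ^ suc n
      ≡⟨ cong (2 ^ n +_) (+-identityʳ (2 ^ n)) ⟩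
    2 ^ n + 2 ^ n ∎)

nCk≤[1+n]Ck : ∀ n k → n C k ≤ suc n C k
nCk≤[1+n]Ck n zero    = ≤-refl
nCk≤[1+n]Ck n (suc k) = ≤-trans (m≤n+m (n C suc k) (n C k))
                                (≤-reflexive (nCk+nC[k+1]≡[n+1]C[k+1] n k))

C-monoˡ-≤ : ∀ k {m n} → m ≤ n → m C k ≤ n C k
C-monoˡ-≤ k = go ∘ ≤⇒≤′
  where
  go : ∀ {m n} → m ≤′ n → m C k ≤ n C k
  go ≤′-refl        = ≤-refl
  go (≤′-step m≤′n) = ≤-trans (go m≤′n) (nCk≤[1+n]Ck _ k)

n≤nC4+3 : ∀ n → n ≤ n C 4 + 3
n≤nC4+3 0 = z≤n
n≤nC4+3 1 = s≤s z≤n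
n≤nC4+3 2 = s≤s (s≤s z≤n)
n≤nC4+3 3 = ≤-refl
n≤nC4+3 (suc n@(suc (suc (suc m)))) = begin
  suc n                 ≤⟨ s≤s (n≤nC4+3 n) ⟩
  1 + (n C 4 + 3)       ≤⟨ +-monoˡ-≤ (n C 4 + 3) (C-monoˡ-≤ 3 {3} {n} (s≤s (s≤s (s≤s z≤n)))) ⟩
  n C 3 + (n C 4 + 3)   ≡⟨ sym (+-assoc (n C 3) (n C 4) 3) ⟩
  n C 3 + n C 4 + 3     ≡⟨ cong (_+ 3) (nCk+nC[k+1]≡[n+1]C[k+1] n 3) ⟩
  suc n C 4 + 3         ∎
  where open ≤-Reasoning

n+nC3≤[1+n]C4+3 : ∀ n → n + n C 3 ≤ suc n C 4 + 3
n+nC3≤[1+n]C4+3 n = begin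
  n + n C 3             ≤⟨ +-monoˡ-≤ (n C 3) (n≤nC4+3 n) ⟩
  n C 4 + 3 + n C 3     ≡⟨ +-comm (n C 4 + 3) (n C 3) ⟩
  n C 3 + (n C 4 + 3)   ≡⟨ sym (+-assoc (n C 3) (n C 4) 3) ⟩
  n C 3 + n C 4 + 3     ≡⟨ cong (_+ 3) (nCk+nC[k+1]≡[n+1]C[k+1] n 3) ⟩
  suc n C 4 + 3         ∎
  where open ≤-Reasoning

blocked : ∀ {n k} → (Fin k → Card n) → List (Card n)
blocked S = subsetSums 1 S ++ subsetSums 3 S

length-blocked : ∀ {n} k (S : Fin k → Card n) → length (blocked S) ≡ k + k C 3
length-blocked k S =
  trans (length-++ (subsetSums 1 S))
        (cong₂ _+_ (trans (length-subsetSums k 1 S) (nC1≡n k)) (length-subsetSums k 3 S))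

module _ {n k} {S : Fin k → Card n} {c : Card n} (c∉blocked : c ∉ blocked S) where

  ∉-blocked⇒≢ : ∀ i → c ≢ S i
  ∉-blocked⇒≢ i c≡Si =
    c∉blocked (∈-++⁺ˡ {ys = subsetSums 3 S} (subst (_∈ _) (sym c≡Si) (∈-subsetSums₁ S i)))

  ∉-blocked⇒≢⊕⊕ : ∀ i j m → i ≢ j → i ≢ m → j ≢ m → c ≢ S i ⊕ S j ⊕ S m
  ∉-blocked⇒≢⊕⊕ i j m i≢j i≢m j≢m c≡sum =
    c∉blocked (∈-++⁺ʳ _ (subst (_∈ _) (sym c≡sum) (∈-subsetSums₃ S i j m i≢j i≢m j≢m)))

noQuadsSet-greedy : ∀ {n} k → (∀ j → j < k → j + j C 3 < 2 ^ n) →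
                    Σ (Fin k → Card n) (NoQuadsSet k)
noQuadsSet-greedy zero _ = (λ ()) , (λ { {()} }) , λ ()
noQuadsSet-greedy {n} (suc k) small
  with S , S-noQuadsSet ← noQuadsSet-greedy k (λ j j<k → small j (m<n⇒m<1+n j<k))
  with c , c∉blocked ← ∃-∉ n (blocked S)
                         (subst (_< 2 ^ n) (sym (length-blocked k S)) (small k ≤-refl))
  = c ◂ S , ◂-noQuadsSet (∉-blocked⇒≢ c∉blocked) (∉-blocked⇒≢⊕⊕ c∉blocked) S-noQuadsSet

theorem11 : (ℓ n : ℕ) → ℓ ≥ 1 → (ℓ C 4) + 3 < 2 ^ n →
    Σ (Fin ℓ → Card n) (λ S → NoQuadsSet ℓ S)
theorem11 ℓ n _ ℓC4+3<2^n = noQuadsSet-greedy ℓ small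
  where
  small : ∀ j → j < ℓ → j + j C 3 < 2 ^ n
  small j j<ℓ = ≤-<-trans (≤-trans (n+nC3≤[1+n]C4+3 j) (+-monoˡ-≤ 3 (C-monoˡ-≤ 4 j<ℓ))) ℓC4+3<2^n
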